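{- Let $k,n\in\mathbb N$ with $k\le n$, let $\lambda\vdash n$ be a partition, let $\pi\in\mathfrak S_n$ be a permutation fixing every $l$ with $1\le l<k$, and let $T$ be a tabloid of shape $\lambda$. Set $\tilde T:=\pi\circ T$, and let $T_x$ and $\tilde T_x$ ($x\in\lambda$) denote the intermediate tabloids arising during the sorting (by the Novelli--Pak--Stoyanovskii algorithm) of $T$ and of $\tilde T$, respectively. Then for every cell $x\in\lambda$, the permutation $\pi_x\in\mathfrak S_n$ defined by $\tilde T_x=\pi_x\circ T_x$ fixes every $l$ with $1\le l<k$.
   Context: A partition $\lambda\vdash n$ is identified with its Young diagram $\{(i,j)\in\mathbb Z^2: i\ge 1,\ 1\le j\le \lambda_i\}$; cell $(i,j)$ lies in row $i$ (rows numbered from top to bottom) and column $j$. The right neighbour of $(i,j)$ is $(i,j+1)$ and the bottom neighbour is $(i+1,j)$ (when these lie in $\lambda$). A tabloid of shape $\lambda$ is a bijection $T:\lambda\to\{1,\dots,n\}$; $\mathfrak S_n$ acts on tabloids by $\pi\cdot T=\pi\circ T$. A standard Young tableau is a tabloid whose entries increase along rows (left to right) and down columns. Sorting algorithm (Novelli--Pak--Stoyanovskii): order the cells by $(i,j)\prec(k,l)$ iff $j<l$, or $j=l$ and $i<k$; let $z_1\prec z_2\prec\dots\prec z_n$ be the cells of $\lambda$. Given a tabloid $T$, set $T_{z_n}:=T$, and for $m=n-1,n-2,\dots,1$ obtain $T_{z_m}$ from $T_{z_{m+1}}$ by the slide at $x=z_m$: let $a:=T_{z_{m+1}}(x)$;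 as long as the cell currently containing $a$ has a right or bottom neighbour whose entry is smaller than $a$, swap $a$ with the smallest of these neighbouring entries. The resulting permutation of entries is denoted $\sigma_x$, so $T_x=\sigma_x\circ T_{z_{m+1}}$ (and $\sigma_{z_n}=\mathrm{id}$). The final tabloid $T_{(1,1)}=T_{z_1}$ is a standard Young tableau. -}

module Defs where

open import Data.Nat using (ℕ; zero; suc; _<_; _≥_; _<?_; _≟_)
open import Data.Fin using (Fin; toℕ)
open import Data.Fin.Permutation using (Permutation′; _⟨$⟩ʳ_)
open import Data.List using (List; []; _∷_; length; upTo; concatMap; mapMaybe; drop)
open import Data.Nat.ListAction using (sum)
open import Data.List.Relation.Unary.All using (All)
open import Data.List.Relation.Unary.Linked using (Linked)
open import Data.Maybe using (Maybe; just; nothing)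
open import Data.Product using (Σ; Σ-syntax; _×_; _,_; proj₁)
open import Data.Bool using (if_then_else_)
open import Relation.Nullary using (yes; no)
open import Relation.Nullary.Decidable using (⌊_⌋; _×-dec_)
open import Relation.Binary.PropositionalEquality using (_≡_)
open import Function.Definitions using (Bijective)

record Partition (n : ℕ) : Set where
  field
    parts      : List ℕ
    decreasing : Linked _≥_ parts
    positive   : All (0 <_) parts
    total      : sum parts ≡ n
open Partition public

rowLen : List ℕ → ℕ → ℕ
rowLen []       _       = 0
rowLen (p ∷ ps) zero    = p
rowLen (p ∷ ps) (suc i) = rowLen ps i

-- Cells, 0-indexed: (i , j) is row i+1, column j+1 of the paper.
Cell : {n : ℕ} → Partition n → Set
Cell λp = Σ[ ij ∈ ℕ × ℕ ] (Data.Product.proj₂ ij < rowLen (parts λp) (proj₁ ij))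

-- Entries: l : Fin n stands for the entry (toℕ l + 1) ∈ {1,…,n}.
-- A filling of the shape; a tabloid is a bijective filling.
Filling : {n : ℕ} → Partition n → Set
Filling {n} λp = Cell λp → Fin n

IsTabloid : {n : ℕ} → (λp : Partition n) → Filling λp → Set
IsTabloid λp T = Bijective _≡_ _≡_ T

module _ {n : ℕ} (λp : Partition n) where

  mkCell : ℕ → ℕ → Maybe (Cell λp)
  mkCell i j with j <? rowLen (parts λp) i
  ... | yes p = just ((i , j) , p)
  ... | no  _ = nothing

  sameCell : Cell λp → Cell λp → Data.Bool.Bool
  sameCell ((i , j) , _) ((i' , j') , _) = ⌊ (i ≟ i') ×-dec (j ≟ j') ⌋

  swapCells : Filling λp → Cell λp → Cell λp → Filling λp
  swapCells U p q c =
    if sameCell c p then U q else (if sameCell c q then U p else U c)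

  candidate : Filling λp → Cell λp → Maybe (Cell λp) → Maybe (Cell λp)
  candidate U p nothing  = nothing
  candidate U p (just c) with toℕ (U c) <? toℕ (U p)
  ... | yes _ = just c
  ... | no  _ = nothing

  smaller : Filling λp → Maybe (Cell λp) → Maybe (Cell λp) → Maybe (Cell λp)
  smaller U nothing  m        = m
  smaller U (just c) nothing  = just c
  smaller U (just c) (just d) with toℕ (U c) <? toℕ (U d)
  ... | yes _ = just c
  ... | no  _ = just d

  nextCell : Filling λp → Cell λp → Maybe (Cell λp)
  nextCell U p@((i , j) , _) =
    smaller U (candidate U p (mkCell i (suc j))) (candidate U p (mkCell (suc i) j))

  -- follow the moving entry (currently at p) with a fuel bound; fuel n suffices
  -- since each swap moves the entry right or down, at most n-1 times.
  slideFuel : ℕ → Cell λp → Filling λp → Filling λp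
  slideFuel zero    p U = U
  slideFuel (suc f) p U with nextCell U p
  ... | nothing = U
  ... | just q  = slideFuel f q (swapCells U p q)

  slide : Cell λp → Filling λp → Filling λp
  slide x U = slideFuel n x U

  -- cells in the order ≺ (column by column, top to bottom): z₁ ≺ z₂ ≺ … ≺ zₙ
  cellOrder : List (Cell λp)
  cellOrder = concatMap (λ j → mapMaybe (λ i → mkCell i j) (upTo (length (parts λp))))
                        (upTo (rowLen (parts λp) 0))

  -- given the suffix zₘ ∷ … ∷ zₙ of the order, compute T_{zₘ}
  stageFrom : List (Cell λp) → Filling λp → Filling λp
  stageFrom []            T = T
  stageFrom (z ∷ [])      T = T
  stageFrom (z ∷ z' ∷ zs) T = slide z (stageFrom (z' ∷ zs) T)

  -- T_x for x = z_{m+1} (m 0-indexed position in cellOrder)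
  stage : ℕ → Filling λp → Filling λp
  stage m T = stageFrom (drop m cellOrder) T

-- Call an entry small if it is below k and large otherwise, and call two fillings equivalent (≈)
-- when their small entries occupy the same cells. T and π ∘ T are equivalent since π fixes the small
-- entries; conversely, if Tₓ and T̃ₓ = πₓ ∘ Tₓ are equivalent then πₓ fixes every small entry, as each
-- one occurs in Tₓ. So it suffices that a slide turns equivalent fillings into equivalent ones.
-- While the moving entry is exchanged with small entries it follows the same path in both fillings;
-- as soon as all entries around it are large, the rest of either slide only exchanges large entries.
-- The latter needs that, in the already sorted part of the diagram, large entries stay large when
-- moving right or down: the jeu-de-taquin sortedness invariant for the 0/1 filling small/large.

module Submission where

open import Defs
open import Data.Nat using (ℕ; zero; suc; _≤_; _<_; _≥_; _+_; _<?_; _≟_; z≤n; s≤s)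
open import Data.Nat.Properties
  using (≤-irrelevant; ≮⇒≥; <⇒≤; ≤-refl; ≤-trans; <-irrefl; <-asym; ≤-<-trans; <-≤-trans
        ; n<1+n; m≤m+n; +-mono-≤-<; +-suc; ≤-antisym)
open import Data.Fin using (Fin; toℕ)
open import Data.Fin.Properties using (toℕ-injective)
open import Data.Fin.Permutation using (Permutation′; _⟨$⟩ʳ_; _⟨$⟩ˡ_; inverseˡ)
open import Data.List using (List; []; _∷_; _++_; [_]; map; mapMaybe; upTo; drop; take; length)
open import Data.List.Properties using (take++drop≡id; ++-assoc)
open import Data.List.Membership.Propositional using (_∈_)
open import Data.List.Membership.Propositional.Properties using (∈-++⁻; ∈-++⁺ʳ; ∈-concatMap⁺; ∈-upTo⁺)
open import Data.List.Relation.Unary.Any using (here; there)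
import Data.List.Relation.Unary.Any as Any
import Data.List.Relation.Unary.Any.Properties as Any
open import Data.List.Relation.Unary.All using (All; []; _∷_)
import Data.List.Relation.Unary.All as All
import Data.List.Relation.Unary.All.Properties as All
open import Data.List.Relation.Unary.AllPairs using (AllPairs; []; _∷_)
import Data.List.Relation.Unary.AllPairs.Properties as AllPairs
open import Data.List.Relation.Unary.Linked using (Linked; _∷_)
open import Data.Nat.ListAction using (sum)
open import Data.Maybe using (Maybe; just; nothing)
import Data.Maybe.Relation.Unary.All as Maybe
import Data.Maybe.Relation.Unary.Any as Maybe
open import Data.Product using (_×_; _,_; proj₁; proj₂)
open import Data.Sum using (_⊎_; inj₁; inj₂)
open import Data.Bool using (true; false; if_then_else_)
open import Data.Empty using (⊥-elim)
open import Function.Definitions using (Injective; Surjective; Bijective)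
open import Relation.Nullary using (¬_; Dec; yes; no)
open import Relation.Binary.PropositionalEquality hiding ([_])

AllPairs-mapMaybe⁺ : ∀ {A B : Set} {R : B → B → Set} (f : A → Maybe B) {xs : List A} →
  AllPairs (λ x y → ∀ {a b} → f x ≡ just a → f y ≡ just b → R a b) xs →
  AllPairs R (mapMaybe f xs)
AllPairs-mapMaybe⁺ f {[]} [] = []
AllPairs-mapMaybe⁺ {R = R} f {x ∷ xs} (Rx ∷ Rxs) with f x
... | nothing = AllPairs-mapMaybe⁺ f Rxs
... | just a  = All.mapMaybe⁺ (All.map⁺ (All.map relate Rx)) ∷ AllPairs-mapMaybe⁺ f Rxs
  where
  relate : ∀ {y} → (∀ {a′ b} → just a ≡ just a′ → f y ≡ just b → R a′ b) → Maybe.All (R a) (f y)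
  relate {y} R-xy with f y
  ... | nothing = Maybe.nothing
  ... | just b  = Maybe.just (R-xy refl refl)

module Sorting {n : ℕ} (λp : Partition n) where

  row col : Cell λp → ℕ
  row c = proj₁ (proj₁ c)
  col c = proj₂ (proj₁ c)

  private variable
    c d p q : Cell λp
    U V : Filling λp

  cell-≡ : ∀ (c d : Cell λp) → row c ≡ row d → col c ≡ col d → c ≡ d
  cell-≡ ((i , j) , _) ((.i , .j) , _) refl refl = cong ((i , j) ,_) (≤-irrelevant _ _)

  _≟ᶜ_ : (c d : Cell λp) → Dec (c ≡ d)
  c ≟ᶜ d with row c ≟ row d | col c ≟ col d
  ... | yes r | yes s = yes (cell-≡ c d r s)
  ... | no ¬r | _     = no (λ e → ¬r (cong row e))
  ... | yes _ | no ¬s = no (λ e → ¬s (cong col e))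

  sameCell-refl : ∀ c → sameCell λp c c ≡ true
  sameCell-refl ((i , j) , _) with i ≟ i | j ≟ j
  ... | yes _ | yes _ = refl
  ... | no ¬r | _     = ⊥-elim (¬r refl)
  ... | yes _ | no ¬s = ⊥-elim (¬s refl)

  sameCell-≢ : ∀ c d → c ≢ d → sameCell λp c d ≡ false
  sameCell-≢ c@((i , j) , _) d@((i' , j') , _) c≢d with i ≟ i' | j ≟ j'
  ... | yes r | yes s = ⊥-elim (c≢d (cell-≡ c d r s))
  ... | yes _ | no _  = refl
  ... | no _  | _     = refl

  transpose : Cell λp → Cell λp → Cell λp → Cell λp
  transpose p q c = if sameCell λp c p then q else (if sameCell λp c q then p else c)

  swapCells-transpose : ∀ (U : Filling λp) p q c → swapCells λp U p q c ≡ U (transpose p q c)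
  swapCells-transpose U p q c with sameCell λp c p | sameCell λp c q
  ... | true  | _     = refl
  ... | false | true  = refl
  ... | false | false = refl

  transpose-p : ∀ p q → transpose p q p ≡ q
  transpose-p p q rewrite sameCell-refl p = refl

  transpose-q : ∀ p q → p ≢ q → transpose p q q ≡ p
  transpose-q p q p≢q rewrite sameCell-≢ q p (≢-sym p≢q) | sameCell-refl q = refl

  transpose-other : ∀ p q c → c ≢ p → c ≢ q → transpose p q c ≡ c
  transpose-other p q c c≢p c≢q rewrite sameCell-≢ c p c≢p | sameCell-≢ c q c≢q = refl

  transpose-involutive : ∀ p q c → transpose p q (transpose p q c) ≡ c
  transpose-involutive p q c with c ≟ᶜ p | c ≟ᶜ q
  ... | yes refl | _ with p ≟ᶜ q
  ...   | yes refl rewrite transpose-p p p = transpose-p p p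
  ...   | no p≢q   rewrite transpose-p p q = transpose-q p q p≢q
  transpose-involutive p q c | no c≢p | yes refl
    rewrite transpose-q p c (≢-sym c≢p) = transpose-p p c
  transpose-involutive p q c | no c≢p | no c≢q
    rewrite transpose-other p q c c≢p c≢q = transpose-other p q c c≢p c≢q

  swapCells-p : ∀ (U : Filling λp) p q → swapCells λp U p q p ≡ U q
  swapCells-p U p q = trans (swapCells-transpose U p q p) (cong U (transpose-p p q))

  swapCells-q : ∀ (U : Filling λp) p q → p ≢ q → swapCells λp U p q q ≡ U p
  swapCells-q U p q p≢q = trans (swapCells-transpose U p q q) (cong U (transpose-q p q p≢q))

  swapCells-other : ∀ (U : Filling λp) p q c → c ≢ p → c ≢ q → swapCells λp U p q c ≡ U c
  swapCells-other U p q c c≢p c≢q =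
    trans (swapCells-transpose U p q c) (cong U (transpose-other p q c c≢p c≢q))

  swapCells-bijective : ∀ p q → Bijective _≡_ _≡_ U → Bijective _≡_ _≡_ (swapCells λp U p q)
  swapCells-bijective {U} p q (U-inj , U-surj) = inj , surj
    where
    open ≡-Reasoning
    τ = transpose p q
    inj : Injective _≡_ _≡_ (swapCells λp U p q)
    inj {c} {d} e = begin
      c           ≡⟨ transpose-involutive p q c ⟨
      τ (τ c)     ≡⟨ cong τ (U-inj (trans (sym (swapCells-transpose U p q c))
                                    (trans e (swapCells-transpose U p q d)))) ⟩
      τ (τ d)     ≡⟨ transpose-involutive p q d ⟩
      d           ∎
    surj : Surjective _≡_ _≡_ (swapCells λp U p q)
    surj y with U-surj y
    ... | c , Uc≡y = τ c , λ { refl → begin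
      swapCells λp U p q (τ c)  ≡⟨ swapCells-transpose U p q (τ c) ⟩
      U (τ (τ c))               ≡⟨ cong U (transpose-involutive p q c) ⟩
      U c                       ≡⟨ Uc≡y refl ⟩
      y                         ∎ }

  -- Neighbouring cells

  data _⋖_ (c d : Cell λp) : Set where
    right⋖ : row d ≡ row c → col d ≡ suc (col c) → c ⋖ d
    below⋖ : row d ≡ suc (row c) → col d ≡ col c → c ⋖ d

  data _≺_ (c d : Cell λp) : Set where
    col< : col c < col d → c ≺ d
    row< : col c ≡ col d → row c < row d → c ≺ d

  ≺-asym : c ≺ d → ¬ d ≺ c
  ≺-asym (col< x)   (col< y)   = <-asym x y
  ≺-asym (col< x)   (row< e _) = <-irrefl (sym e) x
  ≺-asym (row< e _) (col< y)   = <-irrefl (sym e) y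
  ≺-asym (row< _ x) (row< _ y) = <-asym x y

  ≺-irrefl : ¬ c ≺ c
  ≺-irrefl c≺c = ≺-asym c≺c c≺c

  ⋖⇒≺ : c ⋖ d → c ≺ d
  ⋖⇒≺ (right⋖ _ e)  = col< (subst (_ <_) (sym e) (n<1+n _))
  ⋖⇒≺ (below⋖ e e′) = row< (sym e′) (subst (_ <_) (sym e) (n<1+n _))

  ⋖⇒≢ : c ⋖ d → c ≢ d
  ⋖⇒≢ c⋖d refl = ≺-irrefl (⋖⇒≺ c⋖d)

  ⋖-⋖⇒≢ : ∀ {c d e} → c ⋖ d → d ⋖ e → e ≢ c
  ⋖-⋖⇒≢ c⋖d d⋖e refl = ≺-asym (⋖⇒≺ c⋖d) (⋖⇒≺ d⋖e)

  ⋖-diagonal : c ⋖ d → row d + col d ≡ suc (row c + col c)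
  ⋖-diagonal {c} (right⋖ r s) rewrite r | s = +-suc (row c) (col c)
  ⋖-diagonal     (below⋖ r s) rewrite r | s = refl

  diagonal<n : ∀ c → row c + col c < n
  diagonal<n c = subst (row c + col c <_) (total λp)
                       (bound (parts λp) (positive λp) (row c) (col c) (proj₂ c))
    where
    bound : ∀ ps → All (0 <_) ps → ∀ i j → j < rowLen ps i → i + j < sum ps
    bound (p ∷ ps) _          zero    j j< = ≤-trans j< (m≤m+n p (sum ps))
    bound (p ∷ ps) (0<p ∷ ps⁺) (suc i) j j< = +-mono-≤-< 0<p (bound ps ps⁺ i j j<)

  mkCell-just : ∀ i j → mkCell λp i j ≡ just c → row c ≡ i × col c ≡ j
  mkCell-just i j e with j <? rowLen (parts λp) i
  mkCell-just i j refl | yes _ = refl , refl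
  mkCell-just i j ()   | no _

  mkCell-cell : ∀ c → mkCell λp (row c) (col c) ≡ just c
  mkCell-cell c with col c <? rowLen (parts λp) (row c)
  ... | yes _  = cong just (cell-≡ _ c refl refl)
  ... | no c∉λ = ⊥-elim (c∉λ (proj₂ c))

  right below : Cell λp → Maybe (Cell λp)
  right c = mkCell λp (row c) (suc (col c))
  below c = mkCell λp (suc (row c)) (col c)

  ⋖⇒right⊎below : c ⋖ d → right c ≡ just d ⊎ below c ≡ just d
  ⋖⇒right⊎below {d = d} (right⋖ refl refl) = inj₁ (mkCell-cell d)
  ⋖⇒right⊎below {d = d} (below⋖ refl refl) = inj₂ (mkCell-cell d)

  right⇒⋖ : right c ≡ just d → c ⋖ d
  right⇒⋖ e = let r , s = mkCell-just _ _ e in right⋖ r s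

  below⇒⋖ : below c ≡ just d → c ⋖ d
  below⇒⋖ e = let r , s = mkCell-just _ _ e in below⋖ r s

  -- Slides

  _<[_]_ _≤[_]_ : Cell λp → Filling λp → Cell λp → Set
  c <[ U ] d = toℕ (U c) < toℕ (U d)
  c ≤[ U ] d = toℕ (U c) ≤ toℕ (U d)

  Descent : Filling λp → Cell λp → Cell λp → Set
  Descent U p d = p ⋖ d × d <[ U ] p

  record SmallestDescent (U : Filling λp) (p q : Cell λp) : Set where
    field
      ⋖-next     : p ⋖ q
      <-next     : q <[ U ] p
      next-least : ∀ {d} → Descent U p d → q ≤[ U ] d
  open SmallestDescent

  module _ (U : Filling λp) where

    candidate-just : ∀ {m} → candidate λp U p m ≡ just c → m ≡ just c × c <[ U ] p
    candidate-just {p} {c} {just d} e with toℕ (U d) <? toℕ (U p)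
    candidate-just {p} {c} {just d} refl | yes d<p = refl , d<p
    candidate-just {p} {c} {just d} ()   | no _

    candidate-descent : ∀ {m} → m ≡ just d → d <[ U ] p → candidate λp U p m ≡ just d
    candidate-descent {d} {p} refl d<p with toℕ (U d) <? toℕ (U p)
    ... | yes _  = refl
    ... | no d≮p = ⊥-elim (d≮p d<p)

    smaller-just : ∀ a b → smaller λp U a b ≡ just c →
      (a ≡ just c ⊎ b ≡ just c) × (∀ {d} → a ≡ just d ⊎ b ≡ just d → c ≤[ U ] d)
    smaller-just nothing  nothing  ()
    smaller-just nothing  (just x) refl = inj₂ refl , λ { (inj₂ refl) → ≤-refl }
    smaller-just (just x) nothing  refl = inj₁ refl , λ { (inj₁ refl) → ≤-refl }
    smaller-just (just x) (just y) e with toℕ (U x) <? toℕ (U y)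
    smaller-just (just x) (just y) refl | yes x<y =
      inj₁ refl , λ { (inj₁ refl) → ≤-refl ; (inj₂ refl) → <⇒≤ x<y }
    smaller-just (just x) (just y) refl | no x≮y =
      inj₂ refl , λ { (inj₁ refl) → ≮⇒≥ x≮y ; (inj₂ refl) → ≤-refl }

    smaller-nothing : ∀ a b → smaller λp U a b ≡ nothing → a ≡ nothing × b ≡ nothing
    smaller-nothing nothing  nothing  _ = refl , refl
    smaller-nothing nothing  (just x) ()
    smaller-nothing (just x) nothing  ()
    smaller-nothing (just x) (just y) e with toℕ (U x) <? toℕ (U y)
    smaller-nothing (just x) (just y) () | yes _
    smaller-nothing (just x) (just y) () | no _

    Descent⇒candidate : Descent U p d →
      candidate λp U p (right p) ≡ just d ⊎ candidate λp U p (below p) ≡ just d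
    Descent⇒candidate (p⋖d , d<p) with ⋖⇒right⊎below p⋖d
    ... | inj₁ e = inj₁ (candidate-descent e d<p)
    ... | inj₂ e = inj₂ (candidate-descent e d<p)

    candidate⇒Descent :
      candidate λp U p (right p) ≡ just d ⊎ candidate λp U p (below p) ≡ just d → Descent U p d
    candidate⇒Descent (inj₁ e) with candidate-just e
    ... | r , d<p = right⇒⋖ r , d<p
    candidate⇒Descent (inj₂ e) with candidate-just e
    ... | b , d<p = below⇒⋖ b , d<p

    nextCell-just : nextCell λp U p ≡ just q → SmallestDescent U p q
    nextCell-just {p} e with smaller-just (candidate λp U p (right p)) (candidate λp U p (below p)) e
    ... | chosen , least = record
      { ⋖-next     = proj₁ (candidate⇒Descent chosen)
      ; <-next     = proj₂ (candidate⇒Descent chosen)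
      ; next-least = λ desc → least (Descent⇒candidate desc)
      }

    nextCell-nothing : nextCell λp U p ≡ nothing → ¬ Descent U p d
    nextCell-nothing {p} e desc
      with smaller-nothing (candidate λp U p (right p)) (candidate λp U p (below p)) e
         | Descent⇒candidate desc
    ... | r , _ | inj₁ r′ with trans (sym r′) r
    ...   | ()
    nextCell-nothing {p} e desc | _ , b | inj₂ b′ with trans (sym b′) b
    ...   | ()

  slideFuel-just : ∀ f → nextCell λp U p ≡ just q →
    slideFuel λp (suc f) p U ≡ slideFuel λp f q (swapCells λp U p q)
  slideFuel-just f e rewrite e = refl

  slideFuel-nothing : ∀ f → nextCell λp U p ≡ nothing → slideFuel λp (suc f) p U ≡ U
  slideFuel-nothing f e rewrite e = refl

  module _ (P : Filling λp → Set) (swap-P : ∀ {U} p q → P U → P (swapCells λp U p q)) where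

    slideFuel-preserves : ∀ f p U → P U → P (slideFuel λp f p U)
    slideFuel-preserves zero    p U PU = PU
    slideFuel-preserves (suc f) p U PU with nextCell λp U p
    ... | nothing = PU
    ... | just q  = slideFuel-preserves f q (swapCells λp U p q) (swap-P p q PU)

    stageFrom-preserves : ∀ zs U → P U → P (stageFrom λp zs U)
    stageFrom-preserves []            U PU = PU
    stageFrom-preserves (z ∷ [])      U PU = PU
    stageFrom-preserves (z ∷ z′ ∷ zs) U PU =
      slideFuel-preserves n z _ (stageFrom-preserves (z′ ∷ zs) U PU)

  stageFrom-bijective : ∀ zs → Bijective _≡_ _≡_ U → Bijective _≡_ _≡_ (stageFrom λp zs U)
  stageFrom-bijective zs = stageFrom-preserves (Bijective _≡_ _≡_) swapCells-bijective zs _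

  -- The order of the slides

  height width : ℕ
  height = length (parts λp)
  width  = rowLen (parts λp) 0

  column : ℕ → List (Cell λp)
  column j = mapMaybe (λ i → mkCell λp i j) (upTo height)

  in-column : ∀ j → All (λ c → col c ≡ j) (column j)
  in-column j = All.mapMaybe⁺ (All.map⁺ (All.universal spec (upTo height)))
    where
    spec : ∀ i → Maybe.All (λ c → col c ≡ j) (mkCell λp i j)
    spec i with mkCell λp i j in e
    ... | nothing = Maybe.nothing
    ... | just c  = Maybe.just (proj₂ (mkCell-just i j e))

  column-sorted : ∀ j → AllPairs _≺_ (column j)
  column-sorted j = AllPairs-mapMaybe⁺ _ (AllPairs.applyUpTo⁺₁ (λ i → i) height λ i<i′ _ ec ec′ →
    row< (trans (proj₂ (mkCell-just _ _ ec)) (sym (proj₂ (mkCell-just _ _ ec′))))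
         (subst₂ _<_ (sym (proj₁ (mkCell-just _ _ ec))) (sym (proj₁ (mkCell-just _ _ ec′))) i<i′))

  columns-sorted : ∀ {j j′} → j < j′ → All (λ c → All (c ≺_) (column j′)) (column j)
  columns-sorted {j} {j′} j<j′ = All.map (λ col-c → All.map (λ col-c′ →
    col< (subst₂ _<_ (sym col-c) (sym col-c′) j<j′)) (in-column j′)) (in-column j)

  cellOrder-sorted : AllPairs _≺_ (cellOrder λp)
  cellOrder-sorted = AllPairs.concat⁺ {xss = map column (upTo width)}
    (All.map⁺ (All.universal column-sorted (upTo width)))
    (AllPairs.map⁺ (AllPairs.applyUpTo⁺₁ (λ j → j) width (λ j<j′ _ → columns-sorted j<j′)))

  ∈-cellOrder : ∀ c → c ∈ cellOrder λp
  ∈-cellOrder c = ∈-concatMap⁺ column (Any.map (λ { refl → ∈-column }) (∈-upTo⁺ col<width))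
    where
    rowLen≤width : ∀ ps → Linked _≥_ ps → ∀ i → rowLen ps i ≤ rowLen ps 0
    rowLen≤width []           _          i       = z≤n
    rowLen≤width (p ∷ [])     _          zero    = ≤-refl
    rowLen≤width (p ∷ [])     _          (suc i) = z≤n
    rowLen≤width (p ∷ q ∷ ps) _          zero    = ≤-refl
    rowLen≤width (p ∷ q ∷ ps) (q≤p ∷ ps≥) (suc i) = ≤-trans (rowLen≤width (q ∷ ps) ps≥ i) q≤p
    nonempty⇒row : ∀ ps i → 0 < rowLen ps i → i < length ps
    nonempty⇒row (p ∷ ps) zero    _  = s≤s z≤n
    nonempty⇒row (p ∷ ps) (suc i) 0< = s≤s (nonempty⇒row ps i 0<)
    col<width : col c < rowLen (parts λp) 0
    col<width = <-≤-trans (proj₂ c) (rowLen≤width (parts λp) (decreasing λp) (row c))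
    ∈-column : c ∈ column (col c)
    ∈-column = Any.mapMaybe⁺ _ _ (Any.map⁺ (Any.map (λ { refl →
      subst (Maybe.Any (c ≡_)) (sym (mkCell-cell c)) (Maybe.just refl) })
      (∈-upTo⁺ (nonempty⇒row (parts λp) (row c) (≤-<-trans z≤n (proj₂ c))))))

  module _ {pre L : List (Cell λp)} (split : cellOrder λp ≡ pre ++ L) where

    private
      split-sorted : AllPairs _≺_ (pre ++ L)
      split-sorted = subst (AllPairs _≺_) split cellOrder-sorted

      before : c ∈ pre → d ∈ L → c ≺ d
      before {c} {d} c∈pre d∈L = go pre split-sorted c∈pre
        where
        go : ∀ pre → AllPairs _≺_ (pre ++ L) → c ∈ pre → c ≺ d
        go (x ∷ pre) (x≺ ∷ _)  (here refl) = All.lookup x≺ (∈-++⁺ʳ pre d∈L)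
        go (x ∷ pre) (_ ∷ ≺s) (there c∈)  = go pre ≺s c∈

    suffix-sorted : AllPairs _≺_ L
    suffix-sorted = go pre split-sorted
      where
      go : ∀ pre → AllPairs _≺_ (pre ++ L) → AllPairs _≺_ L
      go []        ≺s       = ≺s
      go (_ ∷ pre) (_ ∷ ≺s) = go pre ≺s

    suffix-⋖-closed : c ∈ L → c ⋖ d → d ∈ L
    suffix-⋖-closed {c} {d} c∈L c⋖d with ∈-++⁻ pre (subst (d ∈_) split (∈-cellOrder d))
    ... | inj₂ d∈L   = d∈L
    ... | inj₁ d∈pre = ⊥-elim (≺-asym (⋖⇒≺ c⋖d) (before d∈pre c∈L))

  suffix-head-minimal : ∀ {pre z L} → cellOrder λp ≡ pre ++ z ∷ L → c ∈ z ∷ L → ¬ c ⋖ z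
  suffix-head-minimal split (here refl) c⋖c = ⋖⇒≢ c⋖c refl
  suffix-head-minimal {z = z} {L} split (there c∈L) c⋖z with suffix-sorted {L = z ∷ L} split
  ... | z≺ ∷ _ = ≺-asym (⋖⇒≺ c⋖z) (All.lookup z≺ c∈L)

  -- Small and large entries

  module Threshold (k : ℕ) where

    Small Large : Fin n → Set
    Small v = suc (toℕ v) < k
    Large v = ¬ Small v

    small? : ∀ v → Dec (Small v)
    small? v = suc (toℕ v) <? k

    large-mono : ∀ {a b} → Large a → toℕ a ≤ toℕ b → Large b
    large-mono a-large a≤b b-small = a-large (≤-<-trans (s≤s a≤b) b-small)

    small-mono : ∀ {a b} → Small a → toℕ b ≤ toℕ a → Small b
    small-mono a-small b≤a = ≤-<-trans (s≤s b≤a) a-small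

    small<large : ∀ {a b} → Small a → Large b → toℕ a < toℕ b
    small<large {a} {b} a-small b-large with toℕ a <? toℕ b
    ... | yes a<b = a<b
    ... | no a≮b  = ⊥-elim (b-large (small-mono a-small (≮⇒≥ a≮b)))

    _≈_ : Filling λp → Filling λp → Set
    U ≈ V = ∀ c → U c ≡ V c ⊎ (Large (U c) × Large (V c))

    ≈-refl : U ≈ U
    ≈-refl c = inj₁ refl

    ≈-sym : U ≈ V → V ≈ U
    ≈-sym U≈V c with U≈V c
    ... | inj₁ e              = inj₁ (sym e)
    ... | inj₂ (lU , lV)      = inj₂ (lV , lU)

    ≈-trans : ∀ {U V W} → U ≈ V → V ≈ W → U ≈ W
    ≈-trans U≈V V≈W c with U≈V c | V≈W c
    ... | inj₁ e        | inj₁ e′         = inj₁ (trans e e′)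
    ... | inj₁ e        | inj₂ (lV , lW)  = inj₂ (subst Large (sym e) lV , lW)
    ... | inj₂ (lU , lV) | inj₁ e′        = inj₂ (lU , subst Large e′ lV)
    ... | inj₂ (lU , _) | inj₂ (_ , lW)   = inj₂ (lU , lW)

    ≈-small : U ≈ V → Small (U c) → V c ≡ U c
    ≈-small {c = c} U≈V small with U≈V c
    ... | inj₁ e       = sym e
    ... | inj₂ (lU , _) = ⊥-elim (lU small)

    ≈-large : U ≈ V → Large (U c) → Large (V c)
    ≈-large U≈V lU small = lU (subst Small (sym (≈-small (≈-sym U≈V) small)) small)

    ≈-< : U ≈ V → Small (U c) → c <[ U ] d → c <[ V ] d
    ≈-< {U} {V} {c} {d} U≈V small c<d with U≈V d
    ... | inj₁ e        = subst₂ (λ x y → toℕ x < toℕ y) (sym (≈-small U≈V small)) e c<d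
    ... | inj₂ (_ , lV) = small<large (subst Small (sym (≈-small U≈V small)) small) lV

    ≈-swapCells : ∀ p q → U ≈ V → swapCells λp U p q ≈ swapCells λp V p q
    ≈-swapCells {U} {V} p q U≈V c
      rewrite swapCells-transpose U p q c | swapCells-transpose V p q c = U≈V (transpose p q c)

    swapCells-large-≈ : Large (U p) → Large (U q) → U ≈ swapCells λp U p q
    swapCells-large-≈ {U} {p} {q} lp lq c rewrite swapCells-transpose U p q c with c ≟ᶜ p
    ... | yes refl rewrite transpose-p c q = inj₂ (lp , lq)
    ... | no c≢p with c ≟ᶜ q
    ...   | yes refl rewrite transpose-q p c (≢-sym c≢p) = inj₂ (lq , lp)
    ...   | no c≢q   rewrite transpose-other p q c c≢p c≢q = inj₁ refl

    ≈-permute : (π : Permutation′ n) → (∀ l → Small l → π ⟨$⟩ʳ l ≡ l) → U ≈ (λ c → π ⟨$⟩ʳ U c)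
    ≈-permute {U} π π-fix c with small? (U c)
    ... | yes small = inj₁ (sym (π-fix (U c) small))
    ... | no large  = inj₂ (large , λ small → large (subst Small (π⁻¹-fix small) small))
      where
      π⁻¹-fix : Small (π ⟨$⟩ʳ U c) → π ⟨$⟩ʳ U c ≡ U c
      π⁻¹-fix small = begin
        π ⟨$⟩ʳ U c                     ≡⟨ inverseˡ π ⟨
        π ⟨$⟩ˡ (π ⟨$⟩ʳ (π ⟨$⟩ʳ U c))   ≡⟨ cong (π ⟨$⟩ˡ_) (π-fix _ small) ⟩
        π ⟨$⟩ˡ (π ⟨$⟩ʳ U c)            ≡⟨ inverseˡ π ⟩
        U c                            ∎
        where open ≡-Reasoning

    ≈-fixes-small : (σ : Permutation′ n) → U ≈ V → (∀ c → V c ≡ σ ⟨$⟩ʳ U c) →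
      Surjective _≡_ _≡_ U → ∀ l → Small l → σ ⟨$⟩ʳ l ≡ l
    ≈-fixes-small {U} {V} σ U≈V V≡σU U-surj l small with U-surj l
    ... | c , Uc≡l with Uc≡l refl
    ... | refl = trans (sym (V≡σU c)) (≈-small U≈V small)

    LargeAround : Filling λp → Cell λp → Set
    LargeAround U p = Large (U p) × (∀ {d} → p ⋖ d → Large (U d))

    stuck-large-around : nextCell λp U p ≡ nothing → Large (U p) → LargeAround U p
    stuck-large-around {U} e lp = lp , λ p⋖d →
      large-mono lp (≮⇒≥ (λ d<p → nextCell-nothing U e (p⋖d , d<p)))

    next-large-around : nextCell λp U p ≡ just q → Large (U q) → LargeAround U p
    next-large-around {U} {p} {q} e lq = lp , neighbours
      where
      next = nextCell-just U e
      lp : Large (U p)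
      lp = large-mono lq (<⇒≤ (<-next next))
      neighbours : ∀ {d} → p ⋖ d → Large (U d)
      neighbours {d} p⋖d with toℕ (U d) <? toℕ (U p)
      ... | yes d<p = large-mono lq (next-least next (p⋖d , d<p))
      ... | no d≮p  = large-mono lp (≮⇒≥ d≮p)

    data SlideStep (U : Filling λp) (p : Cell λp) : Set where
      large-phase : LargeAround U p → SlideStep U p
      small-swap  : nextCell λp U p ≡ just q → Small (U q) → SlideStep U p
      small-stop  : nextCell λp U p ≡ nothing → Small (U p) → SlideStep U p

    slideStep : ∀ U p → SlideStep U p
    slideStep U p with nextCell λp U p in e
    ... | nothing with small? (U p)
    ...   | yes small = small-stop e small
    ...   | no large  = large-phase (stuck-large-around e large)
    slideStep U p | just q with small? (U q)
    ...   | yes small = small-swap e small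
    ...   | no large  = large-phase (next-large-around e large)

    nextCell-≈-stop : U ≈ V → nextCell λp U p ≡ nothing → Small (U p) → nextCell λp V p ≡ nothing
    nextCell-≈-stop {U} {V} {p} U≈V e small with nextCell λp V p in e′
    ... | nothing = refl
    ... | just q′ = ⊥-elim (nextCell-nothing U e (p⋖q′ , ≈-< (≈-sym U≈V) small′ q′<p))
      where
      p⋖q′ = ⋖-next (nextCell-just V e′)
      q′<p = <-next (nextCell-just V e′)
      small′ : Small (V q′)
      small′ = small-mono (subst Small (sym (≈-small U≈V small)) small) (<⇒≤ q′<p)

    -- Injectivity of U rules out a tie between the two neighbours of p.
    nextCell-≈-swap : U ≈ V → Injective _≡_ _≡_ U →
      nextCell λp U p ≡ just q → Small (U q) → nextCell λp V p ≡ just q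
    nextCell-≈-swap {U} {V} {p} {q} U≈V U-inj e small with nextCell λp V p in e′
    ... | nothing = ⊥-elim (nextCell-nothing V e′ (p⋖q , q<[V]p))
      where
      p⋖q = ⋖-next (nextCell-just U e)
      q<[V]p = ≈-< U≈V small (<-next (nextCell-just U e))
    ... | just q′ = cong just (U-inj (toℕ-injective (≤-antisym Uq′≤Uq Uq≤Uq′)))
      where
      nextU = nextCell-just U e
      nextV = nextCell-just V e′
      Vq≡Uq = ≈-small U≈V small
      q<[V]p = ≈-< U≈V small (<-next nextU)
      Vq′≤Vq : q′ ≤[ V ] q
      Vq′≤Vq = next-least nextV (⋖-next nextU , q<[V]p)
      small′ : Small (V q′)
      small′ = small-mono (subst Small (sym Vq≡Uq) small) Vq′≤Vq
      Uq′≡Vq′ = ≈-small (≈-sym U≈V) small′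
      Uq≤Uq′ : q ≤[ U ] q′
      Uq≤Uq′ = next-least nextU (⋖-next nextV , ≈-< (≈-sym U≈V) small′ (<-next nextV))
      Uq′≤Uq : q′ ≤[ U ] q
      Uq′≤Uq = subst₂ (λ x y → toℕ x ≤ toℕ y) (sym Uq′≡Vq′) Vq≡Uq Vq′≤Vq

    Sorted : (Cell λp → Set) → Filling λp → Set
    Sorted R U = ∀ {c d} → R c → c ⋖ d → Large (U c) → Large (U d)

    module _ (R : Cell λp → Set) (R-closed : ∀ {c d} → R c → c ⋖ d → R d) where

      -- The invariant of a slide whose moving entry currently sits at p.
      record SortedExcept (U : Filling λp) (p : Cell λp) : Set where
        field
          away    : ∀ {c d} → R c → c ≢ p → c ⋖ d → d ≢ p → Large (U c) → Large (U d)
          through : ∀ {c d} → R c → c ⋖ p → p ⋖ d → Large (U c) → Large (U d)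
          into    : ∀ {c} → R c → c ⋖ p → Large (U c) → Large (U p)

      sortedExcept-step : R p → nextCell λp U p ≡ just q → SortedExcept U p →
        SortedExcept (swapCells λp U p q) q
      sortedExcept-step {p} {U} {q} Rp e S =
        record { away = away′ ; through = through′ ; into = into′ }
        where
        open SortedExcept S
        next = nextCell-just U e
        p⋖q = ⋖-next next
        p≢q = ⋖⇒≢ p⋖q
        q≢p = ≢-sym p≢q
        Rq = R-closed Rp p⋖q
        U′ = swapCells λp U p q

        away′ : ∀ {c d} → R c → c ≢ q → c ⋖ d → d ≢ q → Large (U′ c) → Large (U′ d)
        away′ {c} {d} Rc c≢q c⋖d d≢q with c ≟ᶜ p
        ... | yes refl rewrite swapCells-p U p q | swapCells-other U p q d (≢-sym (⋖⇒≢ c⋖d)) d≢q =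
          λ lq → proj₂ (next-large-around e lq) c⋖d
        ... | no c≢p with d ≟ᶜ p
        ...   | yes refl rewrite swapCells-p U p q | swapCells-other U p q c c≢p c≢q =
          through Rc c⋖d p⋖q
        ...   | no d≢p rewrite swapCells-other U p q c c≢p c≢q | swapCells-other U p q d d≢p d≢q =
          away Rc c≢p c⋖d d≢p

        large-at-q : ∀ {c} → R c → c ⋖ q → Large (U′ c) → Large (U q)
        large-at-q {c} Rc c⋖q with c ≟ᶜ p
        ... | yes refl rewrite swapCells-p U c q = λ l → l
        ... | no c≢p rewrite swapCells-other U p q c c≢p (⋖⇒≢ c⋖q) = away Rc c≢p c⋖q q≢p

        through′ : ∀ {c d} → R c → c ⋖ q → q ⋖ d → Large (U′ c) → Large (U′ d)
        through′ {c} {d} Rc c⋖q q⋖d l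
          rewrite swapCells-other U p q d (⋖-⋖⇒≢ p⋖q q⋖d) (≢-sym (⋖⇒≢ q⋖d)) =
          away Rq q≢p q⋖d (⋖-⋖⇒≢ p⋖q q⋖d) (large-at-q Rc c⋖q l)

        into′ : ∀ {c} → R c → c ⋖ q → Large (U′ c) → Large (U′ q)
        into′ Rc c⋖q l rewrite swapCells-q U p q p≢q =
          large-mono (large-at-q Rc c⋖q l) (<⇒≤ (<-next next))

      sortedExcept-stop : nextCell λp U p ≡ nothing → SortedExcept U p → Sorted R U
      sortedExcept-stop {U} {p} e S {c} {d} Rc c⋖d with c ≟ᶜ p
      ... | yes refl = λ lc → proj₂ (stuck-large-around e lc) c⋖d
      ... | no c≢p with d ≟ᶜ p
      ...   | yes refl = SortedExcept.into S Rc c⋖d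
      ...   | no d≢p   = SortedExcept.away S Rc c≢p c⋖d d≢p

      -- The fuel bound: every swap moves the entry one step further from the corner along
      -- the diagonals, and all diagonals of the shape have index below n.
      slideFuel-sorted : ∀ f p U → R p → SortedExcept U p → n ≤ f + (row p + col p) →
        Sorted R (slideFuel λp f p U)
      slideFuel-sorted zero p U Rp S n≤ = ⊥-elim (<-irrefl refl (≤-<-trans n≤ (diagonal<n p)))
      slideFuel-sorted (suc f) p U Rp S n≤ with nextCell λp U p in e
      ... | nothing = sortedExcept-stop e S
      ... | just q  = slideFuel-sorted f q (swapCells λp U p q) (R-closed Rp p⋖q)
                        (sortedExcept-step Rp e S) (subst (n ≤_) fuel-shift n≤)
        where
        p⋖q = ⋖-next (nextCell-just U e)
        fuel-shift : suc f + (row p + col p) ≡ f + (row q + col q)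
        fuel-shift = trans (sym (+-suc f _)) (cong (f +_) (sym (⋖-diagonal p⋖q)))

      large-slide-≈ : ∀ f p U → R p → SortedExcept U p → LargeAround U p → U ≈ slideFuel λp f p U
      large-slide-≈ zero    p U Rp S around = ≈-refl
      large-slide-≈ (suc f) p U Rp S (lp , ln) with nextCell λp U p in e
      ... | nothing = ≈-refl
      ... | just q  = ≈-trans (swapCells-large-≈ lp (ln p⋖q))
          (large-slide-≈ f q (swapCells λp U p q) Rq (sortedExcept-step Rp e S) around′)
        where
        p⋖q = ⋖-next (nextCell-just U e)
        Rq = R-closed Rp p⋖q
        around′ : LargeAround (swapCells λp U p q) q
        around′ = subst Large (sym (swapCells-q U p q (⋖⇒≢ p⋖q))) lp , λ {d} q⋖d →
          let d≢p = ⋖-⋖⇒≢ p⋖q q⋖d in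
          subst Large (sym (swapCells-other U p q d d≢p (≢-sym (⋖⇒≢ q⋖d))))
            (SortedExcept.away S Rq (≢-sym (⋖⇒≢ p⋖q)) q⋖d d≢p (ln p⋖q))

      slideFuel-≈ : ∀ f p U V → R p → SortedExcept U p → SortedExcept V p → Bijective _≡_ _≡_ U →
        U ≈ V → slideFuel λp f p U ≈ slideFuel λp f p V
      slideFuel-≈ zero    p U V Rp SU SV U-bij U≈V = U≈V
      slideFuel-≈ (suc f) p U V Rp SU SV U-bij U≈V with slideStep U p
      ... | large-phase around = ≈-trans (≈-sym (large-slide-≈ (suc f) p U Rp SU around))
                                   (≈-trans U≈V (large-slide-≈ (suc f) p V Rp SV around′))
        where
        around′ : LargeAround V p
        around′ = ≈-large U≈V (proj₁ around) , λ p⋖d → ≈-large U≈V (proj₂ around p⋖d)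
      ... | small-stop e small
        rewrite slideFuel-nothing f e | slideFuel-nothing f (nextCell-≈-stop U≈V e small) = U≈V
      ... | small-swap {q} e small
        rewrite slideFuel-just f e | slideFuel-just f (nextCell-≈-swap U≈V (proj₁ U-bij) e small) =
        slideFuel-≈ f q (swapCells λp U p q) (swapCells λp V p q) (R-closed Rp p⋖q)
          (sortedExcept-step Rp e SU) (sortedExcept-step Rp eV SV)
          (swapCells-bijective p q U-bij) (≈-swapCells p q U≈V)
        where
        p⋖q = ⋖-next (nextCell-just U e)
        eV = nextCell-≈-swap U≈V (proj₁ U-bij) e small

    module _ {U₀ V₀ : Filling λp} (U₀-bij : Bijective _≡_ _≡_ U₀) (U₀≈V₀ : U₀ ≈ V₀) where

      record SortedAgreement (zs : List (Cell λp)) : Set where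
        field
          agree   : stageFrom λp zs U₀ ≈ stageFrom λp zs V₀
          sortedU : Sorted (_∈ zs) (stageFrom λp zs U₀)
          sortedV : Sorted (_∈ zs) (stageFrom λp zs V₀)

      stageFrom-sortedAgreement : ∀ {pre} z zs → cellOrder λp ≡ pre ++ z ∷ zs →
        SortedAgreement (z ∷ zs)
      stageFrom-sortedAgreement z [] split =
        record { agree = U₀≈V₀ ; sortedU = singleton ; sortedV = singleton }
        where
        singleton : ∀ {U} → Sorted (_∈ [ z ]) U
        singleton c∈ c⋖d with suffix-⋖-closed split c∈ c⋖d | c∈
        ... | here refl | here refl = ⊥-elim (⋖⇒≢ c⋖d refl)
      stageFrom-sortedAgreement {pre} z (z′ ∷ zs) split = record
        { agree   = slideFuel-≈ R R-closed n z U₁ V₁ (here refl) (start sortedU) (start sortedV)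
                      (stageFrom-bijective (z′ ∷ zs) U₀-bij) agree
        ; sortedU = slideFuel-sorted R R-closed n z U₁ (here refl) (start sortedU) (m≤m+n n _)
        ; sortedV = slideFuel-sorted R R-closed n z V₁ (here refl) (start sortedV) (m≤m+n n _)
        }
        where
        open SortedAgreement
          (stageFrom-sortedAgreement z′ zs (trans split (sym (++-assoc pre [ z ] (z′ ∷ zs)))))
        R : Cell λp → Set
        R = _∈ z ∷ z′ ∷ zs
        R-closed : ∀ {c d} → R c → c ⋖ d → R d
        R-closed = suffix-⋖-closed split
        U₁ V₁ : Filling λp
        U₁ = stageFrom λp (z′ ∷ zs) U₀
        V₁ = stageFrom λp (z′ ∷ zs) V₀
        start : ∀ {W} → Sorted (_∈ z′ ∷ zs) W → SortedExcept R R-closed W z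
        start S = record
          { away    = λ { (here refl) c≢z → ⊥-elim (c≢z refl) ; (there c∈) _ c⋖d _ → S c∈ c⋖d }
          ; through = λ c∈ c⋖z → ⊥-elim (suffix-head-minimal split c∈ c⋖z)
          ; into    = λ c∈ c⋖z → ⊥-elim (suffix-head-minimal split c∈ c⋖z)
          }

      stageFrom-≈ : ∀ pre zs → cellOrder λp ≡ pre ++ zs → stageFrom λp zs U₀ ≈ stageFrom λp zs V₀
      stageFrom-≈ pre []       split = U₀≈V₀
      stageFrom-≈ pre (z ∷ zs) split = SortedAgreement.agree (stageFrom-sortedAgreement z zs split)

lemma1p1 : (k n : ℕ) → k ≤ n → (λp : Partition n) → (π : Permutation′ n)
    → (∀ (l : Fin n) → suc (toℕ l) < k → π ⟨$⟩ʳ l ≡ l)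
    → (T : Filling λp) → IsTabloid λp T
    → (m : ℕ) → m < length (cellOrder λp)
    → (πₓ : Permutation′ n)
    → (∀ (c : Cell λp) → stage λp m (λ c' → π ⟨$⟩ʳ T c') c ≡ πₓ ⟨$⟩ʳ stage λp m T c)
    → ∀ (l : Fin n) → suc (toℕ l) < k → πₓ ⟨$⟩ʳ l ≡ l
lemma1p1 k n _ λp π π-fix T T-bij m _ πₓ πₓ-stage =
  ≈-fixes-small πₓ stage-≈ πₓ-stage (proj₂ (stageFrom-bijective (drop m order) T-bij))
  where
  open Sorting λp
  open Threshold k
  order = cellOrder λp
  stage-≈ : stage λp m T ≈ stage λp m (λ c → π ⟨$⟩ʳ T c)
  stage-≈ = stageFrom-≈ T-bij (≈-permute π π-fix) (take m order) (drop m order)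
              (sym (take++drop≡id m order))
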